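{- Let $f_{mi}(t)$ ($m\geqslant 0$, $0\leqslant i\leqslant m+1$) be the polynomials defined in the context. For all integers $m,i$ with $1\leqslant i\leqslant m+1$, we have $\deg f_{mi}(t)=m+1-i$, and the leading coefficient $c_{mi}$ of $f_{mi}(t)$ satisfies $(-1)^mc_{mi}>0$.
   Context: The polynomials $f_{mi}(t)\in\mathbb{Q}[t]$, for integers $m\geqslant 0$ and $0\leqslant i\leqslant m+1$, are defined by $f_{00}(t)=\frac12 t-1$, $f_{01}(t)=1$ and, for $m\geqslant 1$: $f_{m0}(t)=tf_{m-1,0}'(t)$; $f_{m,m+1}(t)=-mf_{m-1,m}(t)$; and $f_{mi}(t)=tf'_{m-1,i}(t)+i(1-t)f_{m-1,i}(t)-(i-1)f_{m-1,i-1}(t)$ for $1\leqslant i\leqslant m$. (They are the polynomials for which $D^m f(t)=\sum_{i=0}^{m+1}f_{mi}(t)h(t)^i$, where $h(t)=t/(e^t-1)$, $f(t)=h(t)-1+t/2$ and $D=t\frac{d}{dt}$.) -}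

module Defs where

open import Data.Nat as ℕ using (ℕ; zero; suc; _∸_)
open import Data.Integer using (+_)
open import Data.Rational using (ℚ; 0ℚ; 1ℚ; ½; _+_; _*_; -_; _-_; _/_; _<_)
open import Data.List using (List; []; _∷_)
open import Relation.Binary.PropositionalEquality using (_≡_; _≢_)
open import Relation.Nullary using (yes; no)

-- Polynomials in ℚ[t] as coefficient lists, lowest degree first
-- (trailing zeros allowed; degree is defined semantically below).
Poly : Set
Poly = List ℚ

coeff : Poly → ℕ → ℚ
coeff []       _       = 0ℚ
coeff (a ∷ p)  zero    = a
coeff (a ∷ p)  (suc k) = coeff p k

nℚ : ℕ → ℚ
nℚ n = + n / 1

_⊕_ : Poly → Poly → Poly
[]      ⊕ q       = q
(a ∷ p) ⊕ []      = a ∷ p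
(a ∷ p) ⊕ (b ∷ q) = (a + b) ∷ (p ⊕ q)

_·_ : ℚ → Poly → Poly
c · []      = []
c · (a ∷ p) = (c * a) ∷ (c · p)

tX : Poly → Poly
tX p = 0ℚ ∷ p

derivFrom : ℕ → Poly → Poly
derivFrom n []      = []
derivFrom n (a ∷ p) = (nℚ n * a) ∷ derivFrom (suc n) p

deriv : Poly → Poly
deriv []      = []
deriv (a ∷ p) = derivFrom 1 p

-- the polynomials f_{m i}(t); f m i = 0 outside 0 ≤ i ≤ m+1 (never used there)
f : ℕ → ℕ → Poly
f zero zero = (- 1ℚ) ∷ ½ ∷ []
f zero (suc zero) = 1ℚ ∷ []
f zero (suc (suc i)) = []
f (suc m) zero = tX (deriv (f m zero))
f (suc m) (suc j) with j ℕ.≤? m | j ℕ.≟ suc m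
-- 1 ≤ i = j+1 ≤ m+1 :  t f'_{m,i} + i(1-t) f_{m,i} - (i-1) f_{m,i-1}
... | yes _ | _ =
  tX (deriv (f m (suc j)))
  ⊕ ((nℚ (suc j) · (f m (suc j) ⊕ ((- 1ℚ) · tX (f m (suc j)))))
  ⊕ ((- nℚ j) · f m j))
-- i = m+2 : f_{m+1,m+2} = -(m+1) f_{m,m+1}
... | no _ | yes _ = (- nℚ (suc m)) · f m (suc m)
... | no _ | no _ = []

HasDegree : Poly → ℕ → Set
HasDegree p d = (coeff p d ≢ 0ℚ) × (∀ k → d ℕ.< k → coeff p k ≡ 0ℚ)
  where open import Data.Product using (_×_)

leadCoeff : Poly → ℕ → ℚ
leadCoeff p d = coeff p d

negOnePow : ℕ → ℚ
negOnePow zero    = 1ℚ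
negOnePow (suc m) = - negOnePow m

module Submission where

open import Defs
open import Data.Nat using (ℕ; suc; _≤_; _∸_)
open import Data.Rational using (0ℚ; _*_; _<_)
open import Data.Product using (_×_)

open import Data.Nat using (zero; z≤n; s≤s)
import Data.Nat as ℕ
import Data.Nat.Properties as ℕP
open import Data.Rational using (ℚ; 1ℚ; _+_; -_; positive) renaming (_≤_ to _≤ℚ_)
import Data.Rational.Properties as ℚP
open import Data.Rational.Solver using (module +-*-Solver)
open import Data.Product using (_,_)
open import Data.Sum using (inj₁; inj₂)
open import Data.Empty using (⊥-elim)
open import Data.List using ([]; _∷_)
open import Relation.Nullary using (yes; no)
open import Relation.Binary.PropositionalEquality
  using (_≡_; _≢_; refl; sym; trans; cong; cong₂; subst; subst₂; module ≡-Reasoning)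

-- Write σ_m = (-1)^m.  We prove, by induction on m, that for
-- every 0 ≤ j ≤ m the polynomial f_{m,j+1} has all coefficients above
-- degree m-j equal to zero and σ_m times its coefficient of t^(m-j) is
-- positive; this is the theorem, since a positive product forces the
-- coefficient to be nonzero.  The coefficient of t^k of the recurrence
--   D a + c(1-t) a - e b          (c = j+1, e = j)
-- is  k a_k + c (a_k - a_{k-1}) - e b_k.  If a has degree d with sign σ
-- and e b has degree ≤ d+1 with e·σ·b_{d+1} ≥ 0, then the result has
-- degree d+1 and its top coefficient  -c a_d - e b_{d+1}  has sign -σ.
-- The last polynomial f_{m+1,m+2} = -(m+1) f_{m,m+1} just changes sign.

coeff-⊕ : ∀ p q k → coeff (p ⊕ q) k ≡ coeff p k + coeff q k
coeff-⊕ []      q       k       = sym (ℚP.+-identityˡ _)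
coeff-⊕ (a ∷ p) []      k       = sym (ℚP.+-identityʳ _)
coeff-⊕ (a ∷ p) (b ∷ q) zero    = refl
coeff-⊕ (a ∷ p) (b ∷ q) (suc k) = coeff-⊕ p q k

coeff-· : ∀ c p k → coeff (c · p) k ≡ c * coeff p k
coeff-· c []      k       = sym (ℚP.*-zeroʳ c)
coeff-· c (a ∷ p) zero    = refl
coeff-· c (a ∷ p) (suc k) = coeff-· c p k

coeff-derivFrom : ∀ n p k → coeff (derivFrom n p) k ≡ nℚ (n ℕ.+ k) * coeff p k
coeff-derivFrom n []      k       = sym (ℚP.*-zeroʳ (nℚ (n ℕ.+ k)))
coeff-derivFrom n (a ∷ p) zero    = cong (λ x → nℚ x * a) (sym (ℕP.+-identityʳ n))
coeff-derivFrom n (a ∷ p) (suc k) =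
  trans (coeff-derivFrom (suc n) p k) (cong (λ x → nℚ x * coeff p k) (sym (ℕP.+-suc n k)))

coeff-D : ∀ p k → coeff (tX (deriv p)) k ≡ nℚ k * coeff p k
coeff-D p       zero    = sym (ℚP.*-zeroˡ (coeff p zero))
coeff-D []      (suc k) = sym (ℚP.*-zeroʳ (nℚ (suc k)))
coeff-D (a ∷ p) (suc k) = coeff-derivFrom 1 p k

nℚ-pos : ∀ n → 0ℚ < nℚ (suc n)
nℚ-pos n = ℚP.positive⁻¹ _ {{ℚP.normalize-pos (suc n) 1}}

*-pos : ∀ {x y} → 0ℚ < x → 0ℚ < y → 0ℚ < x * y
*-pos {x} {y} 0<x 0<y =
  subst (_< x * y) (ℚP.*-zeroʳ x) (ℚP.*-monoʳ-<-pos x {{positive 0<x}} 0<y)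

-- "Top coefficient with a sign": p vanishes above degree d and σ·p_d > 0
-- (Lead), resp. σ·p_d ≥ 0 (WeakLead, used for the term -e·b, where e may
-- be 0).

Vanishes : Poly → ℕ → Set
Vanishes p d = ∀ k → d ℕ.< k → coeff p k ≡ 0ℚ

record Lead (p : Poly) (d : ℕ) (σ : ℚ) : Set where
  constructor _,_
  field
    vanishes : Vanishes p d
    signed   : 0ℚ < σ * coeff p d

record WeakLead (p : Poly) (d : ℕ) (σ : ℚ) : Set where
  constructor _,_
  field
    vanishes : Vanishes p d
    signed   : 0ℚ ≤ℚ σ * coeff p d

Lead⇒HasDegree : ∀ {p d σ} → Lead p d σ → HasDegree p d
Lead⇒HasDegree {p} {d} {σ} (vanish , pos) = nonzero , vanish
  where
  nonzero : coeff p d ≢ 0ℚ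
  nonzero p_d≡0 = ℚP.<-irrefl (sym (trans (cong (σ *_) p_d≡0) (ℚP.*-zeroʳ σ))) pos

Lead⇒WeakLead : ∀ {p d σ} → Lead p d σ → WeakLead p d σ
Lead⇒WeakLead (vanish , pos) = vanish , ℚP.<⇒≤ pos

·-vanishes : ∀ c {p d} → Vanishes p d → Vanishes (c · p) d
·-vanishes c {p} vanish k d<k =
  trans (coeff-· c p k) (trans (cong (c *_) (vanish k d<k)) (ℚP.*-zeroʳ c))

Lead-scale : ∀ {c p d σ} → 0ℚ < c → Lead p d σ → Lead (c · p) d σ
Lead-scale {c} {p} {d} {σ} 0<c (vanish , pos) =
  ·-vanishes c {p} vanish , subst (0ℚ <_) (sym top) (*-pos 0<c pos)
  where
  open +-*-Solver
  top : σ * coeff (c · p) d ≡ c * (σ * coeff p d)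
  top = trans (cong (σ *_) (coeff-· c p d))
    (solve 3 (λ σ c x → σ :* (c :* x) := c :* (σ :* x)) refl σ c (coeff p d))

Lead-negScale : ∀ {c p d σ} → 0ℚ < c → Lead p d σ → Lead ((- c) · p) d (- σ)
Lead-negScale {c} {p} {d} {σ} 0<c (vanish , pos) =
  ·-vanishes (- c) {p} vanish , subst (0ℚ <_) (sym top) (*-pos 0<c pos)
  where
  open +-*-Solver
  top : (- σ) * coeff ((- c) · p) d ≡ c * (σ * coeff p d)
  top = trans (cong ((- σ) *_) (coeff-· (- c) p d))
    (solve 3 (λ σ c x → (:- σ) :* ((:- c) :* x) := c :* (σ :* x)) refl σ c (coeff p d))

zero-scale-weak : ∀ b d σ → WeakLead (0ℚ · b) d σ
zero-scale-weak b d σ = vanish , ℚP.≤-reflexive (sym (trans (cong (σ *_) (zero-coeff d)) (ℚP.*-zeroʳ σ)))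
  where
  zero-coeff : ∀ k → coeff (0ℚ · b) k ≡ 0ℚ
  zero-coeff k = trans (coeff-· 0ℚ b k) (ℚP.*-zeroˡ (coeff b k))
  vanish : Vanishes (0ℚ · b) d
  vanish k _ = zero-coeff k

recurrence : ℚ → ℚ → Poly → Poly → Poly
recurrence c e a b = tX (deriv a) ⊕ ((c · (a ⊕ ((- 1ℚ) · tX a))) ⊕ ((- e) · b))

coeff-recurrence : ∀ c e a b k →
  coeff (recurrence c e a b) k
    ≡ nℚ k * coeff a k + (c * (coeff a k + (- 1ℚ) * coeff (tX a) k) + - coeff (e · b) k)
coeff-recurrence c e a b k = begin
  coeff (recurrence c e a b) k
    ≡⟨ coeff-⊕ (tX (deriv a)) ((c · (a ⊕ ((- 1ℚ) · tX a))) ⊕ ((- e) · b)) k ⟩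
  coeff (tX (deriv a)) k + coeff ((c · (a ⊕ ((- 1ℚ) · tX a))) ⊕ ((- e) · b)) k
    ≡⟨ cong₂ _+_ (coeff-D a k) (coeff-⊕ (c · (a ⊕ ((- 1ℚ) · tX a))) ((- e) · b) k) ⟩
  nℚ k * coeff a k + (coeff (c · (a ⊕ ((- 1ℚ) · tX a))) k + coeff ((- e) · b) k)
    ≡⟨ cong (λ x → nℚ k * coeff a k + x) (cong₂ _+_ oneMinusT negE) ⟩
  nℚ k * coeff a k + (c * (coeff a k + (- 1ℚ) * coeff (tX a) k) + - coeff (e · b) k)
    ∎
  where
  open ≡-Reasoning
  oneMinusT : coeff (c · (a ⊕ ((- 1ℚ) · tX a))) k ≡ c * (coeff a k + (- 1ℚ) * coeff (tX a) k)
  oneMinusT = trans (coeff-· c (a ⊕ ((- 1ℚ) · tX a)) k)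
    (cong (c *_) (trans (coeff-⊕ a ((- 1ℚ) · tX a) k)
                        (cong (coeff a k +_) (coeff-· (- 1ℚ) (tX a) k))))
  negE : coeff ((- e) · b) k ≡ - coeff (e · b) k
  negE = trans (coeff-· (- e) b k)
    (trans (sym (ℚP.neg-distribˡ-* e (coeff b k))) (cong -_ (sym (coeff-· e b k))))

recurrence-lead : ∀ {c e a b d σ} → 0ℚ < c → Lead a d σ → WeakLead (e · b) (suc d) σ →
  Lead (recurrence c e a b) (suc d) (- σ)
recurrence-lead {c} {e} {a} {b} {d} {σ} 0<c (vanishA , posA) (vanishB , nonnegB) =
  vanish , subst (0ℚ <_) (sym top) (ℚP.+-mono-<-≤ (*-pos 0<c posA) nonnegB)
  where
  open +-*-Solver
  vanish : Vanishes (recurrence c e a b) (suc d)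
  vanish (suc k) (s≤s d<k) = begin
    coeff (recurrence c e a b) (suc k)
      ≡⟨ coeff-recurrence c e a b (suc k) ⟩
    nℚ (suc k) * coeff a (suc k) + (c * (coeff a (suc k) + (- 1ℚ) * coeff a k) + - coeff (e · b) (suc k))
      ≡⟨ cong₂ (λ x y → nℚ (suc k) * x + (c * (x + (- 1ℚ) * y) + - coeff (e · b) (suc k)))
               (vanishA (suc k) (ℕP.m<n⇒m<1+n d<k)) (vanishA k d<k) ⟩
    nℚ (suc k) * 0ℚ + (c * (0ℚ + (- 1ℚ) * 0ℚ) + - coeff (e · b) (suc k))
      ≡⟨ cong (λ x → nℚ (suc k) * 0ℚ + (c * (0ℚ + (- 1ℚ) * 0ℚ) + - x)) (vanishB (suc k) (s≤s d<k)) ⟩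
    nℚ (suc k) * 0ℚ + (c * (0ℚ + (- 1ℚ) * 0ℚ) + - 0ℚ)
      ≡⟨ solve 2 (λ n c → n :* con 0ℚ :+ (c :* (con 0ℚ :+ (:- con 1ℚ) :* con 0ℚ) :+ (:- con 0ℚ))
                          := con 0ℚ) refl (nℚ (suc k)) c ⟩
    0ℚ
      ∎
    where open ≡-Reasoning
  top : (- σ) * coeff (recurrence c e a b) (suc d) ≡ c * (σ * coeff a d) + σ * coeff (e · b) (suc d)
  top = begin
    (- σ) * coeff (recurrence c e a b) (suc d)
      ≡⟨ cong ((- σ) *_) (coeff-recurrence c e a b (suc d)) ⟩
    (- σ) * (nℚ (suc d) * coeff a (suc d) + (c * (coeff a (suc d) + (- 1ℚ) * coeff a d) + - coeff (e · b) (suc d)))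
      ≡⟨ cong (λ x → (- σ) * (nℚ (suc d) * x + (c * (x + (- 1ℚ) * coeff a d) + - coeff (e · b) (suc d))))
              (vanishA (suc d) (ℕP.n<1+n d)) ⟩
    (- σ) * (nℚ (suc d) * 0ℚ + (c * (0ℚ + (- 1ℚ) * coeff a d) + - coeff (e · b) (suc d)))
      ≡⟨ solve 5 (λ σ n c x y → (:- σ) :* (n :* con 0ℚ :+ (c :* (con 0ℚ :+ (:- con 1ℚ) :* x) :+ (:- y)))
                                := c :* (σ :* x) :+ σ :* y)
               refl σ (nℚ (suc d)) c (coeff a d) (coeff (e · b) (suc d)) ⟩
    c * (σ * coeff a d) + σ * coeff (e · b) (suc d)
      ∎
    where open ≡-Reasoning

f-recurrence : ∀ {m j} → j ≤ m →
  f (suc m) (suc j) ≡ recurrence (nℚ (suc j)) (nℚ j) (f m (suc j)) (f m j)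
f-recurrence {m} {j} j≤m with j ℕ.≤? m | j ℕ.≟ suc m
... | yes _   | _ = refl
... | no j≰m | _ = ⊥-elim (j≰m j≤m)

f-last : ∀ m → f (suc m) (suc (suc m)) ≡ (- nℚ (suc m)) · f m (suc m)
f-last m with suc m ℕ.≤? m | suc m ℕ.≟ suc m
... | yes 1+m≤m | _       = ⊥-elim (ℕP.1+n≰n 1+m≤m)
... | no _      | yes _   = refl
... | no _      | no 1+m≢ = ⊥-elim (1+m≢ refl)

Claim : ℕ → Set
Claim m = ∀ j → j ≤ m → Lead (f m (suc j)) (m ∸ j) (negOnePow m)

claim-base : Claim 0
claim-base zero z≤n = vanish , ℚP.positive⁻¹ _
  where
  vanish : Vanishes (f 0 1) 0
  vanish (suc k) _ = refl

lower-term : ∀ {m} → Claim m → ∀ j → j ≤ m →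
  WeakLead (nℚ j · f m j) (suc (m ∸ j)) (negOnePow m)
lower-term {m} claim zero    _    = zero-scale-weak (f m zero) (suc m) (negOnePow m)
lower-term {m} claim (suc j) j<m =
  Lead⇒WeakLead (Lead-scale (nℚ-pos j)
    (subst (λ d → Lead (f m (suc j)) d (negOnePow m))
           (ℕP.+-∸-assoc 1 j<m) (claim j (ℕP.<⇒≤ j<m))))

claim-step : ∀ {m} → Claim m → Claim (suc m)
claim-step {m} claim j j≤1+m with ℕP.m≤n⇒m<n∨m≡n j≤1+m
... | inj₁ (s≤s j≤m) =
  subst₂ (λ p d → Lead p d (negOnePow (suc m)))
         (sym (f-recurrence j≤m)) (sym (ℕP.+-∸-assoc 1 j≤m))
         (recurrence-lead (nℚ-pos j) (claim j j≤m) (lower-term claim j j≤m))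
... | inj₂ refl =
  subst (λ p → Lead p (m ∸ m) (negOnePow (suc m)))
        (sym (f-last m)) (Lead-negScale (nℚ-pos m) (claim m ℕP.≤-refl))

claim : ∀ m → Claim m
claim zero    = claim-base
claim (suc m) = claim-step (claim m)

lemma2p1 : (m i : ℕ) → 1 ≤ i → i ≤ suc m →
    HasDegree (f m i) (suc m ∸ i)
    × (0ℚ < negOnePow m * leadCoeff (f m i) (suc m ∸ i))
lemma2p1 m (suc j) _ (s≤s j≤m) = Lead⇒HasDegree lead , Lead.signed lead
  where
  lead : Lead (f m (suc j)) (m ∸ j) (negOnePow m)
  lead = claim m j j≤m
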